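{- Let $X$ be a finite non-empty set and $R$ a monotone transit function on $X$ satisfying (uc): for all $x,y,u,v\in X$, if $R(x,y)\cap R(u,v)\neq\emptyset$ then there are $p,q\in R(x,y)\cup R(u,v)$ with $R(x,y)\cup R(u,v)=R(p,q)$. Then $R$ satisfies (w): for all $x,y,z\in X$, $z\in R(x,y)$ or $y\in R(x,z)$ or $x\in R(y,z)$; and (wp): for all $u,v,x,y,p,q\in X$, if $R(u,v)\cap R(x,y)$, $R(u,v)\cap R(p,q)$ and $R(x,y)\cap R(p,q)$ are all non-empty, then $R(p,q)\subseteq R(u,v)\cup R(x,y)$ or $R(u,v)\subseteq R(p,q)\cup R(x,y)$ or $R(x,y)\subseteq R(p,q)\cup R(u,v)$.
   Context: A transit function on a finite non-empty set $X$ is a map $R:X\times X\to 2^X$ such that for all $u,v\in X$: $u\in R(u,v)$, $R(u,v)=R(v,u)$, and $R(u,u)=\{u\}$. $R$ is monotone if for all $u,v,p,q\in X$, $p,q\in R(u,v)$ implies $R(p,q)\subseteq R(u,v)$. -}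

module Defs where

open import Data.Nat using (ℕ)
open import Data.Fin using (Fin)
open import Data.Fin.Subset using (Subset; _∈_; _⊆_; _∪_; _∩_; Nonempty; ⁅_⁆)
open import Data.Product using (_×_; ∃-syntax)
open import Data.Sum using (_⊎_)
open import Relation.Binary.PropositionalEquality using (_≡_)

IsTransit : ∀ {n} → (Fin n → Fin n → Subset n) → Set
IsTransit {n} R =
  (∀ u v → u ∈ R u v) × (∀ u v → R u v ≡ R v u) × (∀ u → R u u ≡ ⁅ u ⁆)

IsMonotone : ∀ {n} → (Fin n → Fin n → Subset n) → Set
IsMonotone {n} R = ∀ u v p q → p ∈ R u v → q ∈ R u v → R p q ⊆ R u v

UC : ∀ {n} → (Fin n → Fin n → Subset n) → Set
UC {n} R = ∀ x y u v → Nonempty (R x y ∩ R u v) →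
  ∃[ p ] ∃[ q ] (p ∈ R x y ∪ R u v × q ∈ R x y ∪ R u v × R x y ∪ R u v ≡ R p q)

W : ∀ {n} → (Fin n → Fin n → Subset n) → Set
W {n} R = ∀ x y z → z ∈ R x y ⊎ y ∈ R x z ⊎ x ∈ R y z

WP : ∀ {n} → (Fin n → Fin n → Subset n) → Set
WP {n} R = ∀ u v x y p q →
  Nonempty (R u v ∩ R x y) → Nonempty (R u v ∩ R p q) → Nonempty (R x y ∩ R p q) →
  R p q ⊆ R u v ∪ R x y ⊎ R u v ⊆ R p q ∪ R x y ⊎ R x y ⊆ R p q ∪ R u v

{-# OPTIONS --safe #-}
-- Call a set C convex if R s t ⊆ C whenever s, t ∈ C: monotonicity says every
-- R u v is convex, and with (uc) so is the union of two intersecting R-sets.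
-- If R s t is covered by three convex sets and each of s, t lies in two of
-- them, then s and t share one of them, which therefore contains R s t.
-- For (w), apply this to R x y, R x z, R y z and the R p q that (uc) makes
-- equal to R x y ∪ R x z: the triangle inclusion R x z ⊆ R x y ∪ R y z puts
-- every point of R p q into two of the three sets.  For (wp), apply it to the
-- pairwise unions of the three sets, whose union is one R s t by (uc) twice.
module Submission where

open import Defs
open import Data.Nat using (ℕ; suc)
open import Data.Fin using (Fin)
open import Data.Fin.Subset using (Subset; _∈_; _⊆_; _∪_; _∩_; Nonempty)
open import Data.Fin.Subset.Properties
  using (x∈p∪q⁻; x∈p∪q⁺; x∈p∩q⁺; x∈p∩q⁻; ⊆-reflexive; ∩-comm)
open import Data.Product using (_×_; _,_; proj₁; proj₂; ∃-syntax)
open import Data.Sum using (_⊎_; inj₁; inj₂; map)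
open import Function using (_∘_)
open import Relation.Binary.PropositionalEquality using (_≡_; subst; sym; trans; cong)

private
  variable
    n : ℕ
    A A′ B C : Subset n
    s t w : Fin n

∈-∪ˡ : w ∈ A → w ∈ A ∪ B
∈-∪ˡ = x∈p∪q⁺ ∘ inj₁

∈-∪ʳ : w ∈ B → w ∈ A ∪ B
∈-∪ʳ = x∈p∪q⁺ ∘ inj₂

nonempty-∩-comm : Nonempty (A ∩ B) → Nonempty (B ∩ A)
nonempty-∩-comm {A = A} {B = B} = subst Nonempty (∩-comm A B)

nonempty-∩-monoˡ : A ⊆ A′ → Nonempty (A ∩ B) → Nonempty (A′ ∩ B)
nonempty-∩-monoˡ {A = A} {B = B} A⊆A′ (w , w∈A∩B) =
  let w∈A , w∈B = x∈p∩q⁻ A B w∈A∩B in w , x∈p∩q⁺ (A⊆A′ w∈A , w∈B)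

Convex : (Fin n → Fin n → Subset n) → Subset n → Set
Convex R C = ∀ s t → s ∈ C → t ∈ C → R s t ⊆ C

data TwoOf (A B C : Subset n) (w : Fin n) : Set where
  ab : w ∈ A → w ∈ B → TwoOf A B C w
  ac : w ∈ A → w ∈ C → TwoOf A B C w
  bc : w ∈ B → w ∈ C → TwoOf A B C w

oneOf⇒twoOf-pairwise-∪ : w ∈ (A ∪ B) ∪ C → TwoOf (A ∪ B) (C ∪ B) (C ∪ A) w
oneOf⇒twoOf-pairwise-∪ {A = A} {B = B} {C = C} w∈
  with x∈p∪q⁻ (A ∪ B) C w∈
... | inj₂ w∈C = bc (∈-∪ˡ w∈C) (∈-∪ˡ w∈C)
... | inj₁ w∈A∪B with x∈p∪q⁻ A B w∈A∪B
...   | inj₁ w∈A = ac w∈A∪B (∈-∪ʳ w∈A)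
...   | inj₂ w∈B = ab w∈A∪B (∈-∪ʳ w∈B)

module _ {n : ℕ} {R : Fin n → Fin n → Subset n} where

  interval-⊆-common : Convex R A → Convex R B → Convex R C →
    TwoOf A B C s → TwoOf A B C t → R s t ⊆ A ⊎ R s t ⊆ B ⊎ R s t ⊆ C
  interval-⊆-common cA cB cC (ab i _) (ab j _) = inj₁ (cA _ _ i j)
  interval-⊆-common cA cB cC (ab i _) (ac j _) = inj₁ (cA _ _ i j)
  interval-⊆-common cA cB cC (ab _ i) (bc j _) = inj₂ (inj₁ (cB _ _ i j))
  interval-⊆-common cA cB cC (ac i _) (ab j _) = inj₁ (cA _ _ i j)
  interval-⊆-common cA cB cC (ac i _) (ac j _) = inj₁ (cA _ _ i j)
  interval-⊆-common cA cB cC (ac _ i) (bc _ j) = inj₂ (inj₂ (cC _ _ i j))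
  interval-⊆-common cA cB cC (bc i _) (ab _ j) = inj₂ (inj₁ (cB _ _ i j))
  interval-⊆-common cA cB cC (bc _ i) (ac _ j) = inj₂ (inj₂ (cC _ _ i j))
  interval-⊆-common cA cB cC (bc i _) (bc j _) = inj₂ (inj₁ (cB _ _ i j))

  module _ (monotone : IsMonotone R) (uc : UC R) where

    ∪-convex : ∀ {a b c d} → Nonempty (R a b ∩ R c d) → Convex R (R a b ∪ R c d)
    ∪-convex {a} {b} {c} {d} ne with uc a b c d ne
    ... | p , q , _ , _ , ∪≡ = subst (Convex R) (sym ∪≡) (monotone p q)

    ∪₃-interval : ∀ {u v x y p q} →
      Nonempty (R u v ∩ R x y) → Nonempty (R u v ∩ R p q) →
      ∃[ s ] ∃[ t ] ((R u v ∪ R x y) ∪ R p q ≡ R s t)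
    ∪₃-interval {u} {v} {x} {y} {p} {q} uv∩xy uv∩pq with uc u v x y uv∩xy
    ... | a , b , _ , _ , ab≡ with uc a b p q
          (nonempty-∩-monoˡ (⊆-reflexive ab≡ ∘ ∈-∪ˡ) uv∩pq)
    ...   | s , t , _ , _ , st≡ = s , t , trans (cong (_∪ R p q) ab≡) st≡

    module _ (transit : IsTransit R) where

      R-left : ∀ u v → u ∈ R u v
      R-left = proj₁ transit

      ∈-R-sym : ∀ {u v} → w ∈ R u v → w ∈ R v u
      ∈-R-sym {w = w} {u} {v} = subst (w ∈_) (proj₁ (proj₂ transit) u v)

      R-right : ∀ u v → v ∈ R u v
      R-right u v = ∈-R-sym (R-left v u)

      R-triangle : ∀ a b c → R a c ⊆ R a b ∪ R b c
      R-triangle a b c =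
        ∪-convex (b , x∈p∩q⁺ (R-right a b , R-left b c)) a c
          (∈-∪ˡ (R-left a b)) (∈-∪ʳ (R-right b c))

      twoOf-triangle : ∀ {x y z} → w ∈ R x y ∪ R x z → TwoOf (R x y) (R x z) (R y z) w
      twoOf-triangle {x = x} {y} {z} w∈ with x∈p∪q⁻ (R x y) (R x z) w∈
      ... | inj₁ w∈xy with x∈p∪q⁻ (R x z) (R z y) (R-triangle x z y w∈xy)
      ...   | inj₁ w∈xz = ab w∈xy w∈xz
      ...   | inj₂ w∈zy = ac w∈xy (∈-R-sym w∈zy)
      twoOf-triangle {x = x} {y} {z} w∈ | inj₂ w∈xz
        with x∈p∪q⁻ (R x y) (R y z) (R-triangle x y z w∈xz)
      ...   | inj₁ w∈xy = ab w∈xy w∈xz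
      ...   | inj₂ w∈yz = bc w∈xz w∈yz

      w-axiom : W R
      w-axiom x y z with uc x y x z (x , x∈p∩q⁺ (R-left x y , R-left x z))
      ... | p , q , p∈ , q∈ , ∪≡ =
        map (λ pq⊆xy → pq⊆xy (∈pq (∈-∪ʳ (R-right x z))))
          (map (λ pq⊆xz → pq⊆xz (∈pq (∈-∪ˡ (R-right x y))))
               (λ pq⊆yz → pq⊆yz (∈pq (∈-∪ˡ (R-left x y)))))
          (interval-⊆-common (monotone x y) (monotone x z) (monotone y z)
            (twoOf-triangle p∈) (twoOf-triangle q∈))
        where
        ∈pq : ∀ {i} → i ∈ R x y ∪ R x z → i ∈ R p q
        ∈pq = ⊆-reflexive ∪≡

      wp-axiom : WP R
      wp-axiom u v x y p q uv∩xy uv∩pq xy∩pq with ∪₃-interval uv∩xy uv∩pq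
      ... | s , t , ∪₃≡ =
        map (via ∈-∪ʳ) (map (via (∈-∪ˡ ∘ ∈-∪ˡ)) (via (∈-∪ˡ ∘ ∈-∪ʳ)))
          (interval-⊆-common (∪-convex uv∩xy)
            (∪-convex (nonempty-∩-comm xy∩pq)) (∪-convex (nonempty-∩-comm uv∩pq))
            (twoOf (R-left s t)) (twoOf (R-right s t)))
        where
        ∪₃ : Subset n
        ∪₃ = (R u v ∪ R x y) ∪ R p q
        twoOf : ∀ {i} → i ∈ R s t → TwoOf (R u v ∪ R x y) (R p q ∪ R x y) (R p q ∪ R u v) i
        twoOf = oneOf⇒twoOf-pairwise-∪ ∘ ⊆-reflexive (sym ∪₃≡)
        via : ∀ {S T} → S ⊆ ∪₃ → R s t ⊆ T → S ⊆ T
        via S⊆ st⊆T = st⊆T ∘ ⊆-reflexive ∪₃≡ ∘ S⊆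

theorem4 : (n : ℕ) (R : Fin (suc n) → Fin (suc n) → Subset (suc n)) →
    IsTransit R → IsMonotone R → UC R → W R × WP R
theorem4 n R transit monotone uc =
  w-axiom monotone uc transit , wp-axiom monotone uc transit
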